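{- Let $P$ be a ca-program. A set of atoms $M$ is a stable model of $P$ (in the sense of ca-programs) if and only if $M$ is a stable model of the mca-program with constraints $e_{\mathit{mca}}(P)$ (in the sense of mca-programs).
   Context: Let $\mathit{At}$ be a set of propositional atoms. Ca-programs. - A cardinality atom (c-atom) is an expression $kXl$ with $X \subseteq \mathit{At}$ finite and integers $0 \leq k \leq l \leq |X|$. - $M \models kXl$ iff $k \leq |M \cap X| \leq l$. - A ca-clause $r$ is $A \leftarrow B_1, \ldots, B_n$ with c-atoms $A$ (the head) and $B_i$ (the body). - A ca-program is a set of ca-clauses. - $M$ satisfies $r$ if $M \models A$ whenever $M \models B_i$ for all $i$; $M \models P$ if it satisfies all clauses. NSS stable models. The NSS-reduct $P^M$ is obtained by: 1. deleting every clause with some body c-atom not satisfied by $M$; 2. replacing each remaining clause $kXl \leftarrow k_1Y_1l_1, \ldots, k_nY_nl_n$ by all clauses $1\{a\} \leftarrow k_1Y_1, \ldots, k_nY_n$ for $a \in X \cap M$. This is a Horn mca-program in which every head is $1\{a\}$. Its least model $\mathit{lm}(P^M)$ is the least set $N$ such that, for every clause, $N \models$ all body mc-atoms implies $a \in N$. $M$ is a stable model of the ca-program $P$ if $M = \mathit{lm}(P^M)$ and $M \models P$. Mca-programs: syntax and satisfaction. - An mc-atom is an expression $kX$ with $X \subseteq \mathit{At}$ finite and $k$ a non-negative integer, with $\mathit{aset}(kX) = X$. - $M \models kX$ iff $|M \cap X| \geq k$, and $M \models \mathbf{not}(kX)$ iff $|M \cap X| < k$. - An mca-clause $r$ is $H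 \leftarrow L_1, \ldots, L_m$ with mc-atom head $\mathit{hd}(r)$, mc-literal body $\mathit{bd}(r)$ (literals $A$ or $\mathbf{not}(A)$), and $\mathit{hset}(r) = \mathit{aset}(\mathit{hd}(r))$. - A constraint mca-clause is $\leftarrow L_1, \ldots, L_m$. $M$ satisfies it iff some $L_i$ is not satisfied by $M$. - $\mathit{hset}(Q) = \bigcup_{r \in Q} \mathit{hset}(r)$. Mca-programs: semantics. - $Q(M) = \{r \in Q : M \models \mathit{bd}(r)\}$. - $T^{\mathit{nd}}_Q(M)$ is the set of all $M'$ with $M' \subseteq \mathit{hset}(Q(M))$ and $M' \models \mathit{hd}(r)$ for all $r \in Q(M)$. - For Horn $Q$ (no $\mathbf{not}$ in bodies), a $Q$-computation is a sequence $(X_n)_{n \geq 0}$ with $X_0 = \emptyset$, $X_n \subseteq X_{n+1}$ and $X_{n+1} \in T^{\mathit{nd}}_Q(X_n)$; a derivable model is the union of a $Q$-computation. - For a (non-constraint) mca-program $Q$, the reduct $Q^M$ removes each clause whose body contains $\mathbf{not}(A)$ with $M \models A$ and deletes all $\mathbf{not}(A)$ literals from the remaining clauses; $M$ is a stable model of $Q$ if $M$ is a derivable model of $Q^M$. - For an mca-program $Q$ possibly containing constraint clauses, $M$ is a stable model of $Q$ if $M$ is a stable model of the set of non-constraint clauses of $Q$ and $M$ satisfies every constraint clause of $Q$. Translation. For a ca-clause $r = kXl \leftarrow k_1X_1l_1, \ldots, k_mX_ml_m$, let - $e^1_{\mathit{mca}}(r)$ be $kX \leftarrow k_1X_1, \ldots,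 k_mX_m, \mathbf{not}((l_1+1)X_1), \ldots, \mathbf{not}((l_m+1)X_m)$; - $e^2_{\mathit{mca}}(r)$ be the constraint $\leftarrow (l+1)X, k_1X_1, \ldots, k_mX_m, \mathbf{not}((l_1+1)X_1), \ldots, \mathbf{not}((l_m+1)X_m)$; - $e_{\mathit{mca}}(P) = \bigcup_{r \in P} \{e^1_{\mathit{mca}}(r), e^2_{\mathit{mca}}(r)\}$. Here expressions $(l+1)X$ with $l+1 > |X|$ are permitted, with the same satisfaction condition; thus they are satisfied by no set. -}

module Defs where

open import Level using (0ℓ)
open import Data.Nat using (ℕ; suc; _≤_)
open import Data.List using (List; []; _∷_; length; map; _++_)
open import Data.List.Membership.Propositional using (_∈_)
open import Data.List.Relation.Unary.All using (All)
open import Data.List.Relation.Unary.Unique.Propositional using (Unique)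
open import Data.Product using (Σ; _×_; _,_)
open import Data.Sum using (_⊎_)
open import Data.Unit using (⊤)
open import Relation.Nullary using (¬_)
open import Relation.Unary using (Pred)
open import Relation.Binary.PropositionalEquality using (_≡_)

module _ {At : Set} where

  AtomSet : Set₁
  AtomSet = Pred At 0ℓ

  AtLeast : ℕ → List At → AtomSet → Set
  AtLeast k X M =
    Σ (List At) λ L → length L ≡ k × Unique L × All (λ a → a ∈ X × M a) L

  SameSet : AtomSet → AtomSet → Set
  SameSet M N = (∀ a → M a → N a) × (∀ a → N a → M a)

  record CAtom : Set where
    constructor cat
    field
      lo     : ℕ
      X      : List At
      hi     : ℕ
      uniq   : Unique X
      lo≤hi  : lo ≤ hi
      hi≤∣X∣ : hi ≤ length X

  _⊨ᶜ_ : AtomSet → CAtom → Set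
  M ⊨ᶜ c = AtLeast (CAtom.lo c) (CAtom.X c) M × ¬ AtLeast (suc (CAtom.hi c)) (CAtom.X c) M

  record CAClause : Set where
    constructor _⟵_
    field
      head : CAtom
      body : List CAtom

  CAProgram : Set₁
  CAProgram = Pred CAClause 0ℓ

  ModelCA : CAProgram → AtomSet → Set
  ModelCA P M = ∀ r → P r → All (M ⊨ᶜ_) (CAClause.body r) → M ⊨ᶜ CAClause.head r

  record MCAtom : Set where
    constructor mc
    field
      k : ℕ
      X : List At

  _⊨ᵐ_ : AtomSet → MCAtom → Set
  M ⊨ᵐ A = AtLeast (MCAtom.k A) (MCAtom.X A) M

  data MCLit : Set where
    pos : MCAtom → MCLit
    not : MCAtom → MCLit

  satLit : AtomSet → MCLit → Set
  satLit M (pos A) = M ⊨ᵐ A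
  satLit M (not A) = ¬ (M ⊨ᵐ A)

  record Rule : Set where
    constructor _⇐_
    field
      hd : MCAtom
      bd : List MCLit

  data MCAClause : Set where
    rule       : Rule → MCAClause
    constraint : List MCLit → MCAClause

  MCAProgram : Set₁
  MCAProgram = Pred MCAClause 0ℓ

  Rules : MCAProgram → Pred Rule 0ℓ
  Rules Q r = Q (rule r)

  SatConstraint : AtomSet → List MCLit → Set
  SatConstraint M ls = ¬ All (satLit M) ls

  Tnd : Pred Rule 0ℓ → AtomSet → AtomSet → Set
  Tnd Q M M' =
    (∀ a → M' a → Σ Rule λ r → Q r × All (satLit M) (Rule.bd r) × a ∈ MCAtom.X (Rule.hd r))
    × (∀ r → Q r → All (satLit M) (Rule.bd r) → M' ⊨ᵐ Rule.hd r)

  Computation : Pred Rule 0ℓ → (ℕ → AtomSet) → Set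
  Computation Q Xs =
    (∀ a → ¬ Xs 0 a)
    × (∀ n a → Xs n a → Xs (suc n) a)
    × (∀ n → Tnd Q (Xs n) (Xs (suc n)))

  DerivableModel : Pred Rule 0ℓ → AtomSet → Set₁
  DerivableModel Q M =
    Σ (ℕ → AtomSet) λ Xs → Computation Q Xs × SameSet M (λ a → Σ ℕ λ n → Xs n a)

  dropNot : List MCLit → List MCLit
  dropNot []            = []
  dropNot (pos A ∷ ls)  = pos A ∷ dropNot ls
  dropNot (not A ∷ ls)  = dropNot ls

  NotOK : AtomSet → MCLit → Set
  NotOK M (pos A) = ⊤
  NotOK M (not A) = ¬ (M ⊨ᵐ A)

  mcaReduct : Pred Rule 0ℓ → AtomSet → Pred Rule 0ℓ
  mcaReduct Q M r' =
    Σ Rule λ r → Q r × All (NotOK M) (Rule.bd r)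
      × r' ≡ (Rule.hd r ⇐ dropNot (Rule.bd r))

  StableMCA : MCAProgram → AtomSet → Set₁
  StableMCA Q M =
    DerivableModel (mcaReduct (Rules Q) M) M
    × (∀ ls → Q (constraint ls) → SatConstraint M ls)

  -- Horn clause 1{a} ← k₁Y₁, …, kₙYₙ
  record HClause : Set where
    constructor hc
    field
      atom  : At
      hbody : List MCAtom

  toMC : CAtom → MCAtom
  toMC c = mc (CAtom.lo c) (CAtom.X c)

  NSSReduct : CAProgram → AtomSet → Pred HClause 0ℓ
  NSSReduct P M h =
    Σ CAClause λ r → P r × All (M ⊨ᶜ_) (CAClause.body r)
      × HClause.atom h ∈ CAtom.X (CAClause.head r) × M (HClause.atom h)
      × HClause.hbody h ≡ map toMC (CAClause.body r)

  data LM (Q : Pred HClause 0ℓ) : At → Set where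
    derive : ∀ {a} (B : List MCAtom) → Q (hc a B) → All (LM Q ⊨ᵐ_) B → LM Q a

  StableCA : CAProgram → AtomSet → Set
  StableCA P M = SameSet M (LM (NSSReduct P M)) × ModelCA P M

  upperNots : List CAtom → List MCLit
  upperNots B = map (λ c → not (mc (suc (CAtom.hi c)) (CAtom.X c))) B

  e1 : CAClause → MCAClause
  e1 (h ⟵ B) = rule (toMC h ⇐ (map (λ c → pos (toMC c)) B ++ upperNots B))

  e2 : CAClause → MCAClause
  e2 (h ⟵ B) =
    constraint (pos (mc (suc (CAtom.hi h)) (CAtom.X h)) ∷ (map (λ c → pos (toMC c)) B ++ upperNots B))

  emca : CAProgram → MCAProgram
  emca P c = Σ CAClause λ r → P r × (c ≡ e1 r ⊎ c ≡ e2 r)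

{-# OPTIONS --safe #-}
-- The reduct of e_mca(P) w.r.t. M consists exactly of the Horn rules  lo(h) X_h ← lo(c) Y_c (c ∈ B)
-- for the clauses h ← B of P whose body c-atoms respect their upper bounds in M, and the constraints
-- e² say that M respects the upper bound of every head whose body it satisfies.  With this, a step
-- of a computation of that reduct inside M adds only atoms derivable in one step of the NSS reduct,
-- and conversely the stages of the NSS reduct, ∅ ⊆ T ∅ ⊆ T (T ∅) ⊆ …, form such a computation when
-- M is a model.  Since an mc-atom satisfied by the union of a chain is satisfied at some stage, the
-- union of these stages is the least model, which ties the two notions of stability together.
module Submission where

open import Defs
open import Function.Bundles using (_⇔_; mk⇔)
open import Function.Base using (_∘_)
open import Level using (0ℓ)
open import Data.Nat using (ℕ; zero; suc; _⊔_; _≤′_; ≤′-refl; ≤′-step)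
open import Data.Nat.Properties using (m≤m⊔n; m≤n⊔m; ≤⇒≤′)
open import Data.List using (List; []; _∷_; map; _++_)
open import Data.List.Properties using (++-identityʳ)
open import Data.List.Membership.Propositional using (_∈_)
open import Data.List.Relation.Unary.All as All using (All; []; _∷_)
open import Data.List.Relation.Unary.All.Properties using (map⁺; map⁻; ++⁺; ++⁻ˡ; ++⁻ʳ)
open import Data.Product using (_×_; _,_; ∃; proj₁; proj₂)
open import Data.Sum using (inj₁; inj₂)
open import Data.Unit using (tt)
open import Data.Empty using (⊥-elim)
open import Relation.Nullary using (¬_)
open import Relation.Unary using (Pred; _⊆_; ∅; ⋃)
open import Relation.Binary.PropositionalEquality using (_≡_; refl; sym; cong; cong₂; module ≡-Reasoning)
open ≡-Reasoning

module _ {A : Set} (F : ℕ → Pred A 0ℓ) (step : ∀ n → F n ⊆ F (suc n)) where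

  chain-mono : ∀ {m n} → m ≤′ n → F m ⊆ F n
  chain-mono ≤′-refl        = λ p → p
  chain-mono (≤′-step m≤n) = step _ ∘ chain-mono m≤n

  All-⋃ : ∀ {xs} → All (⋃ ℕ F) xs → ∃ λ N → All (F N) xs
  All-⋃ [] = 0 , []
  All-⋃ ((n , p) ∷ ps) with All-⋃ ps
  ... | N , qs = n ⊔ N , chain-mono (≤⇒≤′ (m≤m⊔n n N)) p
                       ∷ All.map (chain-mono (≤⇒≤′ (m≤n⊔m n N))) qs

module _ {At : Set} where

  AtLeast-mono-∈ : ∀ {k X} {M N : AtomSet {At}} →
                   (∀ {a} → a ∈ X → M a → N a) → AtLeast k X M → AtLeast k X N
  AtLeast-mono-∈ f (L , len , uniq , members) =
    L , len , uniq , All.map (λ (a∈X , Ma) → a∈X , f a∈X Ma) members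

  ⊨ᵐ-mono : ∀ {A} {M N : AtomSet {At}} → M ⊆ N → M ⊨ᵐ A → N ⊨ᵐ A
  ⊨ᵐ-mono M⊆N = AtLeast-mono-∈ (λ _ → M⊆N)

  module _ (Xs : ℕ → AtomSet {At}) (step : ∀ n → Xs n ⊆ Xs (suc n)) where

    AtLeast-⋃ : ∀ {k X} → AtLeast k X (⋃ ℕ Xs) → ∃ λ N → AtLeast k X (Xs N)
    AtLeast-⋃ {X = X} (L , len , uniq , members)
      with All-⋃ (λ n a → a ∈ X × Xs n a) (λ n (a∈X , x) → a∈X , step n x)
                 (All.map (λ (a∈X , n , x) → n , a∈X , x) members)
    ... | N , members′ = N , L , len , uniq , members′

    ⊨ᵐ-⋃ : ∀ {As} → All (⋃ ℕ Xs ⊨ᵐ_) As → ∃ λ N → All (Xs N ⊨ᵐ_) As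
    ⊨ᵐ-⋃ = All-⋃ (λ n A → Xs n ⊨ᵐ A) (λ n → ⊨ᵐ-mono (step n)) ∘ All.map AtLeast-⋃

  module _ (H : Pred (HClause {At}) 0ℓ) where

    T : AtomSet {At} → AtomSet {At}
    T N a = ∃ λ B → H (hc a B) × All (N ⊨ᵐ_) B

    T-mono : ∀ {N N′} → N ⊆ N′ → T N ⊆ T N′
    T-mono N⊆N′ (B , h , body) = B , h , All.map (⊨ᵐ-mono N⊆N′) body

    Stage : ℕ → AtomSet {At}
    Stage zero    = ∅
    Stage (suc n) = T (Stage n)

    Stage-mono : ∀ n → Stage n ⊆ Stage (suc n)
    Stage-mono zero    ()
    Stage-mono (suc n) = T-mono (Stage-mono n)

    LM-closed : T (LM H) ⊆ LM H
    LM-closed (B , h , body) = derive B h body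

    LM-least : ∀ {S} → T S ⊆ S → LM H ⊆ S
    LM-least {S} closed = lm⊆
      where
      lm⊆      : LM H ⊆ S
      body⊆    : ∀ {B} → All (LM H ⊨ᵐ_) B → All (S ⊨ᵐ_) B
      members⊆ : ∀ {X L} → All (λ a → a ∈ X × LM H a) L → All (λ a → a ∈ X × S a) L

      lm⊆ (derive B h body) = closed (B , h , body⊆ body)

      body⊆ []                                   = []
      body⊆ ((L , len , uniq , members) ∷ body) = (L , len , uniq , members⊆ members) ∷ body⊆ body

      members⊆ []                  = []
      members⊆ ((a∈X , a) ∷ rest) = (a∈X , lm⊆ a) ∷ members⊆ rest

    Stage⊆LM : ∀ n → Stage n ⊆ LM H
    Stage⊆LM zero    ()
    Stage⊆LM (suc n) = LM-closed ∘ T-mono (Stage⊆LM n)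

    LM⊆⋃Stage : LM H ⊆ ⋃ ℕ Stage
    LM⊆⋃Stage = LM-least λ (B , h , body) →
      let N , body′ = ⊨ᵐ-⋃ Stage Stage-mono body in suc N , B , h , body′

  _⊨hi_ : AtomSet {At} → CAtom {At} → Set
  M ⊨hi c = ¬ M ⊨ᵐ mc (suc (CAtom.hi c)) (CAtom.X c)

  mcaBody : List (CAtom {At}) → List (MCLit {At})
  mcaBody B = map (λ c → pos (toMC c)) B ++ upperNots B

  dropNot-++ : (ls ls′ : List (MCLit {At})) → dropNot (ls ++ ls′) ≡ dropNot ls ++ dropNot ls′
  dropNot-++ []           ls′ = refl
  dropNot-++ (pos A ∷ ls) ls′ = cong (pos A ∷_) (dropNot-++ ls ls′)
  dropNot-++ (not A ∷ ls) ls′ = dropNot-++ ls ls′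

  dropNot-pos : {I : Set} (f : I → MCAtom {At}) (xs : List I) →
                dropNot (map (λ x → pos (f x)) xs) ≡ map pos (map f xs)
  dropNot-pos f []       = refl
  dropNot-pos f (x ∷ xs) = cong (pos (f x) ∷_) (dropNot-pos f xs)

  dropNot-upperNots : (B : List (CAtom {At})) → dropNot (upperNots B) ≡ []
  dropNot-upperNots []      = refl
  dropNot-upperNots (c ∷ B) = dropNot-upperNots B

  dropNot-mcaBody : (B : List (CAtom {At})) → dropNot (mcaBody B) ≡ map pos (map toMC B)
  dropNot-mcaBody B = begin
    dropNot (map (λ c → pos (toMC c)) B ++ upperNots B)
      ≡⟨ dropNot-++ (map (λ c → pos (toMC c)) B) (upperNots B) ⟩
    dropNot (map (λ c → pos (toMC c)) B) ++ dropNot (upperNots B)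
      ≡⟨ cong₂ _++_ (dropNot-pos toMC B) (dropNot-upperNots B) ⟩
    map pos (map toMC B) ++ []
      ≡⟨ ++-identityʳ _ ⟩
    map pos (map toMC B) ∎

  mcaBody-sat⁺ : ∀ {M B} → All (M ⊨ᶜ_) B → All (satLit M) (mcaBody B)
  mcaBody-sat⁺ body = let lower , upper = All.unzip body in ++⁺ (map⁺ lower) (map⁺ upper)

  mcaBody-sat⁻ : ∀ {M B} → All (satLit M) (mcaBody B) → All (M ⊨ᶜ_) B
  mcaBody-sat⁻ {B = B} sat = All.zip (map⁻ (++⁻ˡ _ sat) , map⁻ (++⁻ʳ (map (λ c → pos (toMC c)) B) sat))

  module _ (P : CAProgram {At}) (M : AtomSet {At}) where

    data ReductRule : Rule {At} → Set where
      reductRule : ∀ {h B} → P (h ⟵ B) → All (M ⊨hi_) B → ReductRule (toMC h ⇐ map pos (map toMC B))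

  module _ {P : CAProgram {At}} {M : AtomSet {At}} where

    private
      Q : Pred (Rule {At}) 0ℓ
      Q = mcaReduct (Rules (emca P)) M

      H : Pred (HClause {At}) 0ℓ
      H = NSSReduct P M

    emcaReduct⁺ : ∀ {r} → ReductRule P M r → Q r
    emcaReduct⁺ (reductRule {h} {B} Pr upper) =
      (toMC h ⇐ mcaBody B) , (h ⟵ B , Pr , inj₁ refl)
      , ++⁺ (map⁺ (All.universal (λ _ → tt) B)) (map⁺ upper)
      , cong (toMC h ⇐_) (sym (dropNot-mcaBody B))

    emcaReduct⁻ : ∀ {r} → Q r → ReductRule P M r
    emcaReduct⁻ (_ , (h ⟵ B , Pr , inj₁ refl) , notOK , refl) rewrite dropNot-mcaBody B =
      reductRule Pr (map⁻ (++⁻ʳ (map (λ c → pos (toMC c)) B) notOK))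

    constraints⇒⊨hi : (∀ ls → emca P (constraint ls) → SatConstraint M ls) →
                      ∀ {h B} → P (h ⟵ B) → All (M ⊨ᶜ_) B → M ⊨hi h
    constraints⇒⊨hi sat Pr body above = sat _ (_ , Pr , inj₂ refl) (above ∷ mcaBody-sat⁺ body)

    ModelCA⇒constraints : ModelCA P M → ∀ ls → emca P (constraint ls) → SatConstraint M ls
    ModelCA⇒constraints model _ (_ , Pr , inj₂ refl) (above ∷ body) =
      proj₂ (model _ Pr (mcaBody-sat⁻ body)) above

    ⊨ᶜ-body : ∀ {N B} → N ⊆ M → All (N ⊨ᵐ_) (map toMC B) → All (M ⊨hi_) B → All (M ⊨ᶜ_) B
    ⊨ᶜ-body N⊆M lower upper = All.zip (map⁻ (All.map (⊨ᵐ-mono N⊆M) lower) , upper)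

    Tnd-T : ModelCA P M → ∀ {N} → N ⊆ M → Tnd Q N (T H N)
    Tnd-T model {N} N⊆M = produced , λ r Qr → heads (emcaReduct⁻ Qr)
      where
      produced : ∀ a → T H N a → ∃ λ r → Q r × All (satLit N) (Rule.bd r) × a ∈ MCAtom.X (Rule.hd r)
      produced a (_ , (_ ⟵ _ , Pr , body , a∈X , _ , refl) , lower) =
        _ , emcaReduct⁺ (reductRule Pr (All.map proj₂ body)) , map⁺ lower , a∈X

      heads : ∀ {r} → ReductRule P M r → All (satLit N) (Rule.bd r) → T H N ⊨ᵐ Rule.hd r
      heads (reductRule {h} {B} Pr upper) sat =
        AtLeast-mono-∈ (λ a∈X Ma → map toMC B , (h ⟵ B , Pr , body , a∈X , Ma , refl) , map⁻ sat)
                       (proj₁ (model _ Pr body))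
        where body = ⊨ᶜ-body N⊆M (map⁻ sat) upper

    Tnd⇒⊆T : ∀ {N N′} → N ⊆ M → N′ ⊆ M → Tnd Q N N′ → N′ ⊆ T H N
    Tnd⇒⊆T {N} N⊆M N′⊆M (produced , _) {a} a∈N′ =
      let _ , Qr , sat , a∈X = produced a a∈N′ in derivable (emcaReduct⁻ Qr) sat a∈X
      where
      derivable : ∀ {r} → ReductRule P M r → All (satLit N) (Rule.bd r) → a ∈ MCAtom.X (Rule.hd r) → T H N a
      derivable (reductRule {h} {B} Pr upper) sat a∈X =
        map toMC B , (h ⟵ B , Pr , ⊨ᶜ-body N⊆M (map⁻ sat) upper , a∈X , N′⊆M a∈N′ , refl) , map⁻ sat

    StableCA⇒StableMCA : StableCA P M → StableMCA (emca P) M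
    StableCA⇒StableMCA ((M⊆LM , LM⊆M) , model) =
      (Stage H , computation , M⊆⋃Stage , λ a (n , a∈Sn) → Stage⊆M n a∈Sn) , ModelCA⇒constraints model
      where
      Stage⊆M : ∀ n → Stage H n ⊆ M
      Stage⊆M n = LM⊆M _ ∘ Stage⊆LM H n

      computation : Computation Q (Stage H)
      computation = (λ _ ()) , (λ n _ → Stage-mono H n) , λ n → Tnd-T model (Stage⊆M n)

      M⊆⋃Stage : ∀ a → M a → ⋃ ℕ (Stage H) a
      M⊆⋃Stage a = LM⊆⋃Stage H ∘ M⊆LM a

    StableMCA⇒StableCA : StableMCA (emca P) M → StableCA P M
    StableMCA⇒StableCA ((Xs , (Xs₀-empty , Xs-mono , Xs-step) , M⊆⋃Xs , ⋃Xs⊆M) , constraints) =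
      ((λ a Ma → let n , a∈Xn = M⊆⋃Xs a Ma in Xs⊆LM n a∈Xn) , LM⊆M) , model
      where
      Xs⊆M : ∀ n → Xs n ⊆ M
      Xs⊆M n a∈Xn = ⋃Xs⊆M _ (n , a∈Xn)

      Xs⊆LM : ∀ n → Xs n ⊆ LM H
      Xs⊆LM zero    a∈X₀ = ⊥-elim (Xs₀-empty _ a∈X₀)
      Xs⊆LM (suc n) = LM-closed H ∘ T-mono H (Xs⊆LM n) ∘ Tnd⇒⊆T (Xs⊆M n) (Xs⊆M (suc n)) (Xs-step n)

      LM⊆M : ∀ a → LM H a → M a
      LM⊆M a (derive _ (_ , _ , _ , _ , Ma , _) _) = Ma

      model : ModelCA P M
      model (h ⟵ B) Pr body = lower , constraints⇒⊨hi constraints Pr body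
        where
        lower : M ⊨ᵐ toMC h
        lower =
          let N , lowerN = ⊨ᵐ-⋃ Xs (λ n → Xs-mono n _) (map⁺ (All.map (⊨ᵐ-mono (M⊆⋃Xs _) ∘ proj₁) body))
              headN = proj₂ (Xs-step N) _ (emcaReduct⁺ (reductRule Pr (All.map proj₂ body))) (map⁺ lowerN)
          in ⊨ᵐ-mono (Xs⊆M (suc N)) headN

theorem5 : {At : Set} (P : CAProgram {At}) (M : AtomSet {At}) → StableCA P M ⇔ StableMCA (emca P) M
theorem5 P M = mk⇔ StableCA⇒StableMCA StableMCA⇒StableCA
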